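{- Let $P$ be a normal logic program. Every supported partial model of $P$ is a supported trap space of $P$.
   Context: Fix a first-order language with finitely many constant, function and predicate symbols. A normal logic program (NLP) $P$ is a finite set of rules $p \leftarrow p_1,\dots,p_m, \mathord{\sim} p_{m+1},\dots,\mathord{\sim} p_k$ ($k\ge m\ge 0$). $\mathrm{HB}(P)$ is its Herbrand base (possibly infinite), $\mathrm{gr}(P)$ its ground instantiation; for a ground rule $r$ with positive/negative body atoms $B^+(r)$, $B^-(r)$, $\mathrm{bf}(r)=\bigwedge_{v\in B^+(r)}v\wedge\bigwedge_{v\in B^-(r)}\neg v$ ($=1$ for empty body). A three-valued interpretation is a map $I:\mathrm{HB}(P)\to\{0,1,\star\}$; two-valued ones are identified with subsets of $\mathrm{HB}(P)$. $[I]=\{J\subseteq\mathrm{HB}(P): \forall a,\ I(a)\ne\star\Rightarrow J(a)=I(a)\}$. Kleene evaluation: $\neg\star=\star$, conjunction = minimum, disjunction = maximum w.r.t. $0<_t\star<_t1$. $I(\mathrm{rhs}(a))$ is the $\le_t$-maximum of $I(\mathrm{bf}(r))$ over $r\in\mathrm{gr}(P)$ with head $a$ ($0$ if none). A supported partial model of $P$ is a three-valued $I$ with $I(a)=I(\mathrm{rhs}(a))$ for all $a\in\mathrm{HB}(P)$ (a three-valued model of Clark's completion). For two-valued $I$, $T_P(I)(a)=I(\mathrm{rhs}(a))$. A nonempty set $S$ of two-valued interpretations is a supported trap set if $\{T_P(J):J\in S\}\subseteq S$; a three-valued $I$ is a supported trap space if $[I]$ is a supported trap set. -}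

module Defs where

open import Data.Nat using (ℕ)
open import Data.Fin using (Fin)
open import Data.Vec using (Vec; []; _∷_)
open import Data.List using (List; []; _∷_; map; _++_; foldr)
open import Data.List.Membership.Propositional using (_∈_)
open import Data.Bool using (Bool; true; false)
open import Data.Product using (Σ; _×_; _,_; ∃)
open import Data.Sum using (_⊎_)
open import Relation.Binary.PropositionalEquality using (_≡_; _≢_)

record Language : Set where
  field
    nConst : ℕ
    nFun   : ℕ
    nPred  : ℕ
    funArity  : Fin nFun  → ℕ
    predArity : Fin nPred → ℕ

data V3 : Set where
  v0 v⋆ v1 : V3

data _≤t_ : V3 → V3 → Set where
  0≤ : ∀ {x} → v0 ≤t x
  ⋆≤⋆ : v⋆ ≤t v⋆
  ⋆≤1 : v⋆ ≤t v1
  1≤1 : v1 ≤t v1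

¬₃ : V3 → V3
¬₃ v0 = v1
¬₃ v⋆ = v⋆
¬₃ v1 = v0

_∧₃_ : V3 → V3 → V3
v0 ∧₃ y = v0
v⋆ ∧₃ v0 = v0
v⋆ ∧₃ v⋆ = v⋆
v⋆ ∧₃ v1 = v⋆
v1 ∧₃ y = y

⌜_⌝ : Bool → V3
⌜ true ⌝ = v1
⌜ false ⌝ = v0

module Syntax (L : Language) where
  open Language L

  data Term : Set where
    var   : ℕ → Term
    const : Fin nConst → Term
    app   : (f : Fin nFun) → Vec Term (funArity f) → Term

  data GTerm : Set where
    gconst : Fin nConst → GTerm
    gapp   : (f : Fin nFun) → Vec GTerm (funArity f) → GTerm

  record Atom : Set where
    constructor atom
    field
      pred : Fin nPred
      args : Vec Term (predArity pred)

  record GAtom : Set where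
    constructor gatom
    field
      pred : Fin nPred
      args : Vec GTerm (predArity pred)

  record Rule : Set where
    constructor rule
    field
      head : Atom
      pos  : List Atom
      neg  : List Atom

  record GRule : Set where
    constructor grule
    field
      head : GAtom
      pos  : List GAtom
      neg  : List GAtom

  Program : Set
  Program = List Rule

  Subst : Set
  Subst = ℕ → GTerm

  mutual
    substT : Subst → Term → GTerm
    substT σ (var x) = σ x
    substT σ (const c) = gconst c
    substT σ (app f ts) = gapp f (substV σ ts)

    substV : ∀ {n} → Subst → Vec Term n → Vec GTerm n
    substV σ [] = []
    substV σ (t ∷ ts) = substT σ t ∷ substV σ ts

  substA : Subst → Atom → GAtom
  substA σ (atom p ts) = gatom p (substV σ ts)

  substR : Subst → Rule → GRule
  substR σ (rule h ps ns) =
    grule (substA σ h) (map (substA σ) ps) (map (substA σ) ns)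

  InGr : Program → GRule → Set
  InGr P r = Σ Rule λ ρ → (ρ ∈ P) × Σ Subst λ σ → substR σ ρ ≡ r

  Interp3 : Set
  Interp3 = GAtom → V3

  -- two-valued interpretations, identified with subsets of HB(P)
  Interp2 : Set
  Interp2 = GAtom → Bool

  as3 : Interp2 → Interp3
  as3 J a = ⌜ J a ⌝

  ⟦_⟧ : Interp3 → Interp2 → Set
  ⟦ I ⟧ J = ∀ a → I a ≢ v⋆ → ⌜ J a ⌝ ≡ I a

  evalBf : Interp3 → GRule → V3
  evalBf I (grule h ps ns) =
    foldr _∧₃_ v1 (map I ps ++ map (λ a → ¬₃ (I a)) ns)

  -- "I(rhs(a)) = v": v is the ≤t-maximum of I(bf(r)) over the ground
  -- rules r ∈ gr(P) with head a, and v = 0 if there is no such rule.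
  RhsIs : Program → Interp3 → GAtom → V3 → Set
  RhsIs P I a v =
    (∀ r → InGr P r → GRule.head r ≡ a → evalBf I r ≤t v)
    × (v ≡ v0 ⊎ Σ GRule λ r → InGr P r × GRule.head r ≡ a × evalBf I r ≡ v)

  SupportedPartialModel : Program → Interp3 → Set
  SupportedPartialModel P I = ∀ a → RhsIs P I a (I a)

  -- "T_P(J) = J'" for two-valued J, J' : T_P(J)(a) = J(rhs(a))
  TPIs : Program → Interp2 → Interp2 → Set
  TPIs P J J' = ∀ a → RhsIs P (as3 J) a ⌜ J' a ⌝

  SupportedTrapSet : Program → (Interp2 → Set) → Set
  SupportedTrapSet P S =
    (Σ Interp2 S) × (∀ J J' → S J → TPIs P J J' → S J')

  SupportedTrapSpace : Program → Interp3 → Set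
  SupportedTrapSpace P I = SupportedTrapSet P ⟦ I ⟧

-- Order the truth values by information, with ⋆ below 0 and 1.
-- Kleene evaluation is monotone for this order, hence so is I ↦ I(rhs(a)),
-- and [I] is exactly the set of two-valued J lying above I. If J ⊒ I and
-- J' = T_P(J), then J'(a) = J(rhs(a)) ⊒ I(rhs(a)) = I(a), so J' ∈ [I];
-- and [I] is nonempty since ⋆ can be rounded to either truth value.

module Submission where

open import Defs
open import Data.Bool using (Bool; true; false)
open import Data.List.Relation.Binary.Pointwise as Pointwise using (foldr⁺; map⁺; ++⁺)
open import Data.Product using (_,_)
open import Data.Sum using (inj₁; inj₂)
open import Function using (_∘_)
open import Relation.Binary.PropositionalEquality using (_≡_; _≢_; refl; sym; trans; subst)

infix 4 _⊑_

data _⊑_ : V3 → V3 → Set where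
  ⋆⊑ : ∀ {y} → v⋆ ⊑ y
  ⊑-refl : ∀ {x} → x ⊑ x

⊑⇒agree : ∀ {x y} → x ⊑ y → x ≢ v⋆ → y ≡ x
⊑⇒agree ⋆⊑ x≢⋆ with () ← x≢⋆ refl
⊑⇒agree ⊑-refl _   = refl

agree⇒⊑ : ∀ {x y} → (x ≢ v⋆ → y ≡ x) → x ⊑ y
agree⇒⊑ {v⋆} _ = ⋆⊑
agree⇒⊑ {v0} y≡x rewrite y≡x (λ ()) = ⊑-refl
agree⇒⊑ {v1} y≡x rewrite y≡x (λ ()) = ⊑-refl

¬₃-mono-⊑ : ∀ {x y} → x ⊑ y → ¬₃ x ⊑ ¬₃ y
¬₃-mono-⊑ ⋆⊑ = ⋆⊑
¬₃-mono-⊑ ⊑-refl = ⊑-refl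

∧₃-mono-⊑ : ∀ {x x′ y y′} → x ⊑ x′ → y ⊑ y′ → x ∧₃ y ⊑ x′ ∧₃ y′
∧₃-mono-⊑ ⊑-refl ⊑-refl = ⊑-refl
∧₃-mono-⊑ ⋆⊑ ⋆⊑ = ⋆⊑
∧₃-mono-⊑ {v0} ⊑-refl ⋆⊑ = ⊑-refl
∧₃-mono-⊑ {v⋆} ⊑-refl ⋆⊑ = ⋆⊑
∧₃-mono-⊑ {v1} ⊑-refl ⋆⊑ = ⋆⊑
∧₃-mono-⊑ {x′ = v0} ⋆⊑ (⊑-refl {v0}) = ⊑-refl
∧₃-mono-⊑ {x′ = v⋆} ⋆⊑ (⊑-refl {v0}) = ⊑-refl
∧₃-mono-⊑ {x′ = v1} ⋆⊑ (⊑-refl {v0}) = ⊑-refl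
∧₃-mono-⊑ ⋆⊑ (⊑-refl {v⋆}) = ⋆⊑
∧₃-mono-⊑ ⋆⊑ (⊑-refl {v1}) = ⋆⊑

≤t-v0⇒≡ : ∀ {x} → x ≤t v0 → x ≡ v0
≤t-v0⇒≡ 0≤ = refl

v1-≤t⇒≡ : ∀ {x} → v1 ≤t x → x ≡ v1
v1-≤t⇒≡ 1≤1 = refl

round : V3 → Bool
round v1 = true
round _  = false

⊑-round : ∀ x → x ⊑ ⌜ round x ⌝
⊑-round v0 = ⊑-refl
⊑-round v⋆ = ⋆⊑
⊑-round v1 = ⊑-refl

module _ {L : Language} where
  open Syntax L

  _⊑ᴵ_ : Interp3 → Interp3 → Set
  I ⊑ᴵ K = ∀ a → I a ⊑ K a

  ∈⟦⟧⇒⊑ᴵ : ∀ {I J} → ⟦ I ⟧ J → I ⊑ᴵ as3 J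
  ∈⟦⟧⇒⊑ᴵ J∈ a = agree⇒⊑ (J∈ a)

  ⊑ᴵ⇒∈⟦⟧ : ∀ {I J} → I ⊑ᴵ as3 J → ⟦ I ⟧ J
  ⊑ᴵ⇒∈⟦⟧ I⊑J a = ⊑⇒agree (I⊑J a)

  evalBf-mono-⊑ : ∀ {I K} → I ⊑ᴵ K → ∀ r → evalBf I r ⊑ evalBf K r
  evalBf-mono-⊑ {I} {K} I⊑K (grule _ ps ns) =
    foldr⁺ {R = _⊑_} {_•_ = _∧₃_} {_◦_ = _∧₃_} ∧₃-mono-⊑ ⊑-refl
      (++⁺ (map⁺ I K (Pointwise.refl (λ {a} → I⊑K a) {ps}))
           (map⁺ (¬₃ ∘ I) (¬₃ ∘ K) (Pointwise.refl (λ {a} → ¬₃-mono-⊑ (I⊑K a)) {ns})))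

  evalBf-defined : ∀ {I K v} → I ⊑ᴵ K → v ≢ v⋆ → ∀ r → evalBf I r ≡ v → evalBf K r ≡ v
  evalBf-defined I⊑K v≢⋆ r refl = ⊑⇒agree (evalBf-mono-⊑ I⊑K r) v≢⋆

  RhsIs-mono-⊑ : ∀ {P I K a x y} → I ⊑ᴵ K → RhsIs P I a x → RhsIs P K a y → x ⊑ y
  RhsIs-mono-⊑ {x = v⋆} _ _ _ = ⋆⊑
  RhsIs-mono-⊑ {x = v1} _ (_ , inj₁ ()) _
  RhsIs-mono-⊑ {K = K} {x = v1} I⊑K (_ , inj₂ (r , r∈P , head≡a , Ir≡1)) (K≤y , _) =
    agree⇒⊑ λ _ → v1-≤t⇒≡ (subst (_≤t _) Kr≡1 (K≤y r r∈P head≡a))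
    where
    Kr≡1 : evalBf K r ≡ v1
    Kr≡1 = evalBf-defined I⊑K (λ ()) r Ir≡1
  RhsIs-mono-⊑ {x = v0} _ _ (_ , inj₁ y≡0) = agree⇒⊑ λ _ → y≡0
  RhsIs-mono-⊑ {K = K} {x = v0} I⊑K (I≤0 , _) (_ , inj₂ (r , r∈P , head≡a , Kr≡y)) =
    agree⇒⊑ λ _ → trans (sym Kr≡y) Kr≡0
    where
    Kr≡0 : evalBf K r ≡ v0
    Kr≡0 = evalBf-defined I⊑K (λ ()) r (≤t-v0⇒≡ (I≤0 r r∈P head≡a))

open Defs.Syntax

proposition4p2 : (L : Language) (P : Program L) (I : Interp3 L) →
    SupportedPartialModel L P I → SupportedTrapSpace L P I
proposition4p2 L P I supported = (round ∘ I , ⊑ᴵ⇒∈⟦⟧ (⊑-round ∘ I)) , closed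
  where
  closed : ∀ J J′ → ⟦ L ⟧ I J → TPIs L P J J′ → ⟦ L ⟧ I J′
  closed J J′ J∈I J↦J′ = ⊑ᴵ⇒∈⟦⟧ λ a → RhsIs-mono-⊑ (∈⟦⟧⇒⊑ᴵ J∈I) (supported a) (J↦J′ a)
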